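{- Let $n$ be a positive integer and $l=\lfloor n/2\rfloor$. Then $$\sum_{s=0}^{l}K_n(s)=(l+1)K_n-\sum_{i=0}^{l}\ \sum_{\substack{0\le j\le i\\ i+j<n}}\frac{i\,n}{n-i-j}\binom{i}{j}\binom{n-i-j}{i}.$$
   Context: Binomial coefficients satisfy $\binom{m}{k}=0$ for $k>m$. The Tribonacci-Lucas numbers are defined by $K_0=3$, $K_1=1$, $K_2=3$ and $K_{n+3}=K_{n+2}+K_{n+1}+K_n$ for $n\ge0$. For $n\ge1$ and $0\le s\le\lfloor n/2\rfloor$, the incomplete Tribonacci-Lucas numbers are $$K_n(s)=\sum_{i=0}^{s}\ \sum_{\substack{0\le j\le i\\ i+j<n}}\frac{n}{n-i-j}\binom{i}{j}\binom{n-i-j}{i}.$$ -}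

module Defs where

open import Data.Nat as ℕ using (ℕ; zero; suc; _∸_; _<_; ⌊_/2⌋)
open import Data.Nat.Combinatorics using (_C_)
open import Data.Integer using (+_)
open import Data.Rational as ℚ using (ℚ; 0ℚ; _+_; _*_)

K : ℕ → ℕ
K 0 = 3
K 1 = 1
K 2 = 3
K (suc (suc (suc n))) = K (suc (suc n)) ℕ.+ K (suc n) ℕ.+ K n

ι : ℕ → ℚ
ι m = (+ m) ℚ./ 1

Σ≤ : ℕ → (ℕ → ℚ) → ℚ
Σ≤ zero f = f 0
Σ≤ (suc m) f = Σ≤ m f + f (suc m)

-- the summand  n/(n-i-j) * C(i,j) * C(n-i-j,i)  restricted to i + j < n
-- (the restriction i + j < n is exactly n ∸ (i + j) ≠ 0; otherwise the term is 0,
--  i.e. excluded from the sum)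
term : ℕ → ℕ → ℕ → ℚ
term n i j with n ∸ (i ℕ.+ j)
... | zero = 0ℚ
... | suc d = (+ (n ℕ.* (i C j) ℕ.* (suc d C i))) ℚ./ suc d

Kinc : ℕ → ℕ → ℚ
Kinc n s = Σ≤ s (λ i → Σ≤ i (λ j → term n i j))

module Submission where

-- Write l = ⌊n/2⌋ and g i = Σ_{j≤i} n/(n-i-j) C(i,j) C(n-i-j,i), so that
-- K_n(s) = Σ_{i≤s} g i.  The corollary is Abel summation
--     Σ_{s≤l} Σ_{i≤s} g i = (l+1) Σ_{i≤l} g i - Σ_{i≤l} i·g i
-- combined with the closed form Σ_{i≤l} g i = K_n (the complete sum).
--
-- The closed form is proved over ℕ.  Put D n i j = C(i,j) C(n-i-j,i) and let
-- Tr n be the sum of D n over the triangle j ≤ i ≤ ⌊n/2⌋ (outside of which D n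
-- vanishes); Tr n is the Tribonacci number T_{n+1}.  Pascal's rule, applied to
-- both binomials, splits D(n+3) into D(n+2), a row shift of D(n+1) and a
-- diagonal shift of D n; summing gives the Tribonacci recursion for Tr.  The
-- absorption identity k·C(m,k) = m·C(m-1,k-1) shows that the summand of K_n
-- is the natural number D n + (row shift of D(n-2)) + 2·(diagonal shift of
-- D(n-3)), so the complete sum is Tr n + Tr(n-2) + 2·Tr(n-3).  That sequence
-- satisfies the Tribonacci recursion and agrees with K at three places, hence
-- equals K.

module TribonacciCounting where

  open import Defs using (K)
  open import Data.Nat using (ℕ; zero; suc; _+_; _*_; _∸_; _≤_; _<_; _≤′_; ≤′-reflexive; ≤′-step; z≤n; s≤s; s≤s⁻¹; ⌊_/2⌋; pred)
  open import Data.Nat.Properties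
  open import Data.Nat.Combinatorics using (_C_; nCk+nC[k+1]≡[n+1]C[k+1]; k>n⇒nCk≡0)
  open import Data.Nat.Tactic.RingSolver using (solve-∀)
  open import Relation.Binary.PropositionalEquality
  open ≡-Reasoning

  -- Binomial coefficients by Pascal's rule; unlike the library's _C_, which is
  -- computed by division, they can be reasoned about by recursion.
  binom : ℕ → ℕ → ℕ
  binom n zero = 1
  binom zero (suc k) = 0
  binom (suc n) (suc k) = binom n k + binom n (suc k)

  C≡binom : ∀ n k → n C k ≡ binom n k
  C≡binom n zero = refl
  C≡binom zero (suc k) = k>n⇒nCk≡0 {0} {suc k} (s≤s z≤n)
  C≡binom (suc n) (suc k) =
    trans (sym (nCk+nC[k+1]≡[n+1]C[k+1] n k)) (cong₂ _+_ (C≡binom n k) (C≡binom n (suc k)))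

  binom-vanish : ∀ {n k} → n < k → binom n k ≡ 0
  binom-vanish {zero} {suc k} _ = refl
  binom-vanish {suc n} {suc k} (s≤s n<k) =
    cong₂ _+_ (binom-vanish n<k) (binom-vanish (m<n⇒m<1+n n<k))

  binom-1 : ∀ n → binom n 1 ≡ n
  binom-1 zero = refl
  binom-1 (suc n) = cong suc (binom-1 n)

  absorb-step : ∀ k n P Q Y → suc (suc k) * Y ≡ suc n * Q → suc k * (P + Q) ≡ suc n * P →
    suc (suc k) * ((P + Q) + Y) ≡ suc (suc n) * (P + Q)
  absorb-step k n P Q Y hY hPQ = begin
    suc (suc k) * ((P + Q) + Y)                   ≡⟨ expand k (P + Q) Y ⟩
    (suc k * (P + Q) + (P + Q)) + suc (suc k) * Y ≡⟨ cong₂ (λ u v → (u + (P + Q)) + v) hPQ hY ⟩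
    (suc n * P + (P + Q)) + suc n * Q             ≡⟨ collect n P Q ⟩
    suc (suc n) * (P + Q)                         ∎
    where
    expand : ∀ k R Y → suc (suc k) * (R + Y) ≡ (suc k * R + R) + suc (suc k) * Y
    expand = solve-∀
    collect : ∀ n P Q → (suc n * P + (P + Q)) + suc n * Q ≡ suc (suc n) * (P + Q)
    collect = solve-∀

  binom-absorb : ∀ n k → suc k * binom (suc n) (suc k) ≡ suc n * binom n k
  binom-absorb n zero =
    trans (*-identityˡ _) (trans (cong suc (binom-1 n)) (sym (*-identityʳ (suc n))))
  binom-absorb zero (suc k) = *-zeroʳ (suc (suc k))
  binom-absorb (suc n) (suc k) =
    absorb-step k n (binom n k) (binom n (suc k)) (binom (suc n) (suc (suc k)))
      (binom-absorb n (suc k)) (binom-absorb n k)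

  ∸-pred : ∀ m s {d} → suc m ∸ s ≡ suc d → m ∸ s ≡ d
  ∸-pred m s e = trans (sym (pred[m∸n]≡m∸[1+n] (suc m) s)) (cong pred e)

  ∸-slack : ∀ m s {d} → m ∸ s ≡ suc d → m ≡ suc d + s
  ∸-slack m s e = trans (sym (m∸n+n≡m s≤m)) (cong (_+ s) e)
    where
    s≤m : s ≤ m
    s≤m = <⇒≤ (m∸n≢0⇒n<m (λ e′ → 0≢1+n (trans (sym e′) e)))

  Σ< : ℕ → (ℕ → ℕ) → ℕ
  Σ< zero f = 0
  Σ< (suc N) f = Σ< N f + f N

  Σ<-cong : ∀ N {f g} → (∀ i → f i ≡ g i) → Σ< N f ≡ Σ< N g
  Σ<-cong zero eq = refl
  Σ<-cong (suc N) eq = cong₂ _+_ (Σ<-cong N eq) (eq N)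

  Σ<-+ : ∀ N f g → Σ< N (λ i → f i + g i) ≡ Σ< N f + Σ< N g
  Σ<-+ zero f g = refl
  Σ<-+ (suc N) f g = trans (cong (_+ (f N + g N)) (Σ<-+ N f g)) (swap (Σ< N f) (Σ< N g) (f N) (g N))
    where
    swap : ∀ a b c d → (a + b) + (c + d) ≡ (a + c) + (b + d)
    swap = solve-∀

  Σ<-* : ∀ N c f → Σ< N (λ i → c * f i) ≡ c * Σ< N f
  Σ<-* zero c f = sym (*-zeroʳ c)
  Σ<-* (suc N) c f = trans (cong (_+ c * f N) (Σ<-* N c f)) (sym (*-distribˡ-+ c (Σ< N f) (f N)))

  Σ<-zero : ∀ N f → (∀ i → f i ≡ 0) → Σ< N f ≡ 0
  Σ<-zero zero f z = refl
  Σ<-zero (suc N) f z = cong₂ _+_ (Σ<-zero N f z) (z N)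

  Σ<-shift : ∀ N f → Σ< (suc N) f ≡ f 0 + Σ< N (λ i → f (suc i))
  Σ<-shift zero f = sym (+-identityʳ (f 0))
  Σ<-shift (suc N) f = trans (cong (_+ f (suc N)) (Σ<-shift N f)) (+-assoc (f 0) _ _)

  Σ<-beyond : ∀ {r M} f → (∀ i → r ≤ i → f i ≡ 0) → r ≤ M → Σ< M f ≡ Σ< r f
  Σ<-beyond {r} f vanish r≤M = go (≤⇒≤′ r≤M)
    where
    go : ∀ {M} → r ≤′ M → Σ< M f ≡ Σ< r f
    go (≤′-reflexive refl) = refl
    go (≤′-step r≤′M) =
      trans (cong₂ _+_ (go r≤′M) (vanish _ (≤′⇒≤ r≤′M))) (+-identityʳ _)

  Array : Set
  Array = ℕ → ℕ → ℕ

  tri : ℕ → Array → ℕ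
  tri r f = Σ< r (λ i → Σ< (suc i) (f i))

  tri-cong : ∀ r {f g : Array} → (∀ i j → f i j ≡ g i j) → tri r f ≡ tri r g
  tri-cong r eq = Σ<-cong r (λ i → Σ<-cong (suc i) (eq i))

  tri-+ : ∀ r (f g : Array) → tri r (λ i j → f i j + g i j) ≡ tri r f + tri r g
  tri-+ r f g = trans (Σ<-cong r (λ i → Σ<-+ (suc i) (f i) (g i))) (Σ<-+ r _ _)

  tri-* : ∀ r c (f : Array) → tri r (λ i j → c * f i j) ≡ c * tri r f
  tri-* r c f = trans (Σ<-cong r (λ i → Σ<-* (suc i) c (f i))) (Σ<-* r c _)

  tri-beyond : ∀ {r M} (f : Array) → (∀ i j → r ≤ i → f i j ≡ 0) → r ≤ M → tri M f ≡ tri r f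
  tri-beyond f vanish =
    Σ<-beyond _ (λ i r≤i → Σ<-zero (suc i) (f i) (λ j → vanish i j r≤i))

  ↓ : Array → Array
  ↓ f zero j = 0
  ↓ f (suc i) j = f i j

  ↘ : Array → Array
  ↘ f (suc i) (suc j) = f i j
  ↘ f _ _ = 0

  -- A row shift preserves the triangular sum provided the entry just above
  -- the diagonal of f vanishes (it enters the triangle after the shift).
  tri-↓ : ∀ r (f : Array) → (∀ i → f i (suc i) ≡ 0) → tri (suc r) (↓ f) ≡ tri r f
  tri-↓ r f above = trans (Σ<-shift r _)
    (Σ<-cong r (λ i → trans (cong (Σ< (suc i) (f i) +_) (above i)) (+-identityʳ _)))

  tri-↘ : ∀ r (f : Array) → tri (suc r) (↘ f) ≡ tri r f
  tri-↘ r f = trans (Σ<-shift r _) (Σ<-cong r (λ i → Σ<-shift (suc i) (↘ f (suc i))))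

  W : ℕ → Array
  W m i j = binom i j * binom m i

  D : ℕ → Array
  D n i j = W (n ∸ (i + j)) i j

  W-pascal : ∀ m i j → W (suc m) i j ≡ W m i j + ↓ (W m) i j + ↘ (W m) i j
  W-pascal m zero j = sym (trans (+-identityʳ _) (+-identityʳ _))
  W-pascal m (suc i) zero = first-column (binom m i) (binom m (suc i))
    where
    first-column : ∀ x y → 1 * (x + y) ≡ 1 * y + 1 * x + 0
    first-column = solve-∀
  W-pascal m (suc i) (suc j) = expand (binom i j) (binom i (suc j)) (binom m i) (binom m (suc i))
    where
    expand : ∀ p q x y → (p + q) * (x + y) ≡ (p + q) * y + q * x + p * x
    expand = solve-∀

  -- The arithmetic core of W-absorb: with s = n-i-j, t = i, u = j, P + Q = C(i,j),
  -- Y = C(s,i) and X = C(s-1,i-1), absorption (hypotheses) turns n·C(i,j)·C(s,i)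
  -- into s times a natural number.
  absorb-arith : ∀ s t u P Q X Y → t * Y ≡ s * X → u * (P + Q) ≡ t * P →
    (s + (t + u)) * ((P + Q) * Y) ≡ s * ((P + Q) * Y + Q * X + 2 * (P * X))
  absorb-arith s t u P Q X Y tY≡sX u[P+Q]≡tP = begin
    (s + (t + u)) * (R * Y)                ≡⟨ expand s t u R Y ⟩
    s * (R * Y) + R * (t * Y) + (u * R) * Y ≡⟨ cong (λ v → s * (R * Y) + R * (t * Y) + v * Y) u[P+Q]≡tP ⟩
    s * (R * Y) + R * (t * Y) + (t * P) * Y ≡⟨ regroup (s * (R * Y)) R t P Y ⟩
    s * (R * Y) + (R + P) * (t * Y)        ≡⟨ cong (λ v → s * (R * Y) + (R + P) * v) tY≡sX ⟩
    s * (R * Y) + (R + P) * (s * X)        ≡⟨ collect s P Q X Y ⟩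
    s * (R * Y + Q * X + 2 * (P * X))      ∎
    where
    R : ℕ
    R = P + Q
    expand : ∀ s t u R Y → (s + (t + u)) * (R * Y) ≡ s * (R * Y) + R * (t * Y) + (u * R) * Y
    expand = solve-∀
    regroup : ∀ a R t P Y → a + R * (t * Y) + (t * P) * Y ≡ a + (R + P) * (t * Y)
    regroup = solve-∀
    collect : ∀ s P Q X Y → s * ((P + Q) * Y) + ((P + Q) + P) * (s * X) ≡ s * ((P + Q) * Y + Q * X + 2 * (P * X))
    collect = solve-∀

  W-absorb : ∀ d i j →
    (suc d + (i + j)) * W (suc d) i j ≡ suc d * (W (suc d) i j + ↓ (W d) i j + 2 * ↘ (W d) i j)
  W-absorb d zero zero = corner (suc d)
    where
    corner : ∀ s → (s + 0) * (1 * 1) ≡ s * (1 * 1 + 0 + 2 * 0)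
    corner = solve-∀
  W-absorb d zero (suc j) = trans (*-zeroʳ (suc d + suc j)) (sym (*-zeroʳ (suc d)))
  -- in the first column C(i+1,0) = 1 = 0 + 1 plays the role of P + Q
  W-absorb d (suc i) zero =
    absorb-arith (suc d) (suc i) 0 0 1 (binom d i) (binom (suc d) (suc i))
      (binom-absorb d i) (sym (*-zeroʳ (suc i)))
  W-absorb d (suc i) (suc j) =
    absorb-arith (suc d) (suc i) (suc j) (binom i j) (binom i (suc j)) (binom d i) (binom (suc d) (suc i))
      (binom-absorb d i) (binom-absorb i j)

  D-upper : ∀ n {i j} → i < j → D n i j ≡ 0
  D-upper n {i} {j} i<j = cong (_* binom (n ∸ (i + j)) i) (binom-vanish i<j)

  n<2[1+⌊n/2⌋] : ∀ n → n < suc ⌊ n /2⌋ + suc ⌊ n /2⌋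
  n<2[1+⌊n/2⌋] n = subst (_< suc ⌊ n /2⌋ + suc ⌊ n /2⌋) (⌊n/2⌋+⌈n/2⌉≡n n)
    (+-mono-<-≤ (n<1+n ⌊ n /2⌋) (⌊n/2⌋-mono (n≤1+n (suc n))))

  D-rows : ∀ n {i} j → suc ⌊ n /2⌋ ≤ i → D n i j ≡ 0
  D-rows n {suc i} j h = trans (cong (binom (suc i) j *_) (binom-vanish slack<i)) (*-zeroʳ (binom (suc i) j))
    where
    n<i+i : n < suc i + suc i
    n<i+i = <-≤-trans (n<2[1+⌊n/2⌋] n) (+-mono-≤ h h)
    slack<i : n ∸ (suc i + j) < suc i
    slack<i = ≤-<-trans (∸-monoʳ-≤ n (m≤m+n (suc i) j)) (m<n+o⇒m∸n<o n (suc i) n<i+i)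

  D-overflow : ∀ n i j → n ≤ i + j → 0 < i + j → D n i j ≡ 0
  D-overflow n i j n≤i+j pos = trans (cong (λ m → W m i j) (m≤n⇒m∸n≡0 n≤i+j)) (empty i j pos)
    where
    empty : ∀ i j → 0 < i + j → W 0 i j ≡ 0
    empty zero (suc j) _ = refl
    empty (suc i) j _ = *-zeroʳ (binom (suc i) j)

  shifted : ℕ → ℕ → Array
  shifted k c i j = ↓ (D (1 + k)) i j + c * ↘ (D k) i j

  shifted-overflow : ∀ k c i j → 3 + k ≤ i + j → shifted k c i j ≡ 0
  shifted-overflow k c i j h = cong₂ _+_ (row i j h) (trans (cong (c *_) (diag i j h)) (*-zeroʳ c))
    where
    row : ∀ i j → 3 + k ≤ i + j → ↓ (D (1 + k)) i j ≡ 0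
    row zero j _ = refl
    row (suc i) j (s≤s h) = D-overflow (1 + k) i j (≤-trans (n≤1+n _) h) (≤-trans (s≤s z≤n) h)
    diag : ∀ i j → 3 + k ≤ i + j → ↘ (D k) i j ≡ 0
    diag zero j _ = refl
    diag (suc i) zero _ = refl
    diag (suc i) (suc j) (s≤s h) = D-overflow k i j (≤-trans (n≤1+n _) h′) (≤-trans (s≤s z≤n) h′)
      where
      h′ : suc k ≤ i + j
      h′ = s≤s⁻¹ (subst (2 + k ≤_) (+-suc i j) h)

  shifted-slack : ∀ k c i j {d} → (3 + k) ∸ (i + j) ≡ suc d →
    shifted k c i j ≡ ↓ (W d) i j + c * ↘ (W d) i j
  shifted-slack k c i j slack = cong₂ _+_ (row i j slack) (cong (c *_) (diag i j slack))
    where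
    row : ∀ i j {d} → (3 + k) ∸ (i + j) ≡ suc d → ↓ (D (1 + k)) i j ≡ ↓ (W d) i j
    row zero j _ = refl
    row (suc i) j e = cong (λ m → W m i j) (∸-pred (1 + k) (i + j) e)
    diag : ∀ i j {d} → (3 + k) ∸ (i + j) ≡ suc d → ↘ (D k) i j ≡ ↘ (W d) i j
    diag zero j _ = refl
    diag (suc i) zero _ = refl
    diag (suc i) (suc j) e =
      cong (λ m → W m i j) (∸-pred k (i + j) (trans (cong (2 + k ∸_) (sym (+-suc i j))) e))

  D-pascal : ∀ k i j → D (3 + k) i j ≡ D (2 + k) i j + shifted k 1 i j
  D-pascal k i j = by-slack _ refl
    where
    by-slack : ∀ s → (3 + k) ∸ (i + j) ≡ s → D (3 + k) i j ≡ D (2 + k) i j + shifted k 1 i j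
    by-slack zero slack = trans (D-overflow (3 + k) i j h pos)
        (sym (cong₂ _+_ (D-overflow (2 + k) i j (≤-trans (n≤1+n _) h) pos) (shifted-overflow k 1 i j h)))
      where
      h : 3 + k ≤ i + j
      h = m∸n≡0⇒m≤n slack
      pos : 0 < i + j
      pos = ≤-trans (s≤s z≤n) h
    by-slack (suc m) slack = begin
      D (3 + k) i j                          ≡⟨ cong (λ s → W s i j) slack ⟩
      W (suc m) i j                          ≡⟨ W-pascal m i j ⟩
      W m i j + ↓ (W m) i j + ↘ (W m) i j    ≡⟨ +-assoc (W m i j) _ _ ⟩
      W m i j + (↓ (W m) i j + ↘ (W m) i j)  ≡⟨ cong₂ _+_ (cong (λ s → W s i j) (sym (∸-pred (2 + k) (i + j) slack)))
                                                   (cong (↓ (W m) i j +_) (sym (*-identityˡ _))) ⟩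
      D (2 + k) i j + (↓ (W m) i j + 1 * ↘ (W m) i j)
                                             ≡⟨ cong (D (2 + k) i j +_) (sym (shifted-slack k 1 i j slack)) ⟩
      D (2 + k) i j + shifted k 1 i j        ∎

  -- The summand of K(k+3), as a natural number.
  summand : ℕ → Array
  summand k i j = D (3 + k) i j + shifted k 2 i j

  summand-overflow : ∀ k i j → 3 + k ≤ i + j → summand k i j ≡ 0
  summand-overflow k i j h =
    cong₂ _+_ (D-overflow (3 + k) i j h (≤-trans (s≤s z≤n) h)) (shifted-overflow k 2 i j h)

  summand-slack : ∀ k i j d → (3 + k) ∸ (i + j) ≡ suc d →
    (3 + k) * binom i j * binom (suc d) i ≡ suc d * summand k i j
  summand-slack k i j d slack = begin
    (3 + k) * binom i j * binom (suc d) i   ≡⟨ *-assoc (3 + k) (binom i j) (binom (suc d) i) ⟩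
    (3 + k) * W (suc d) i j                 ≡⟨ cong (_* W (suc d) i j) (∸-slack (3 + k) (i + j) slack) ⟩
    (suc d + (i + j)) * W (suc d) i j       ≡⟨ W-absorb d i j ⟩
    suc d * (W (suc d) i j + ↓ (W d) i j + 2 * ↘ (W d) i j)
                                            ≡⟨ cong (suc d *_) (+-assoc (W (suc d) i j) _ _) ⟩
    suc d * (W (suc d) i j + (↓ (W d) i j + 2 * ↘ (W d) i j))
                                            ≡⟨ cong (λ v → suc d * (v + (↓ (W d) i j + 2 * ↘ (W d) i j)))
                                                 (cong (λ s → W s i j) (sym slack)) ⟩
    suc d * (D (3 + k) i j + (↓ (W d) i j + 2 * ↘ (W d) i j))
                                            ≡⟨ cong (λ v → suc d * (D (3 + k) i j + v)) (sym (shifted-slack k 2 i j slack)) ⟩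
    suc d * summand k i j                   ∎

  Tr : ℕ → ℕ
  Tr n = tri (suc ⌊ n /2⌋) (D n)

  Tr-widen : ∀ n {r} → suc ⌊ n /2⌋ ≤ r → tri r (D n) ≡ Tr n
  Tr-widen n = tri-beyond (D n) (λ i j → D-rows n j)

  -- The shifted pieces sum to Tr(k+1) + c·Tr k; since ⌊(k+3)/2⌋ = 1 + ⌊(k+1)/2⌋
  -- the shifts exactly compensate the extra row.
  tri-shifted : ∀ k c → tri (suc ⌊ 3 + k /2⌋) (shifted k c) ≡ Tr (1 + k) + c * Tr k
  tri-shifted k c = begin
    tri (suc r) (shifted k c)                                   ≡⟨ tri-+ (suc r) _ _ ⟩
    tri (suc r) (↓ (D (1 + k))) + tri (suc r) (λ i j → c * ↘ (D k) i j)
                                                                ≡⟨ cong (tri (suc r) (↓ (D (1 + k))) +_) (tri-* (suc r) c (↘ (D k))) ⟩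
    tri (suc r) (↓ (D (1 + k))) + c * tri (suc r) (↘ (D k))     ≡⟨ cong₂ (λ u v → u + c * v) row diagonal ⟩
    Tr (1 + k) + c * tri r (D k)                                ≡⟨ cong (λ v → Tr (1 + k) + c * v) (Tr-widen k (s≤s (⌊n/2⌋-mono (n≤1+n k)))) ⟩
    Tr (1 + k) + c * Tr k                                       ∎
    where
    r : ℕ
    r = suc ⌊ 1 + k /2⌋
    row : tri (suc r) (↓ (D (1 + k))) ≡ Tr (1 + k)
    row = tri-↓ r (D (1 + k)) (λ i → D-upper (1 + k) (n<1+n i))
    diagonal : tri (suc r) (↘ (D k)) ≡ tri r (D k)
    diagonal = tri-↘ r (D k)

  record Tribonacci (u : ℕ → ℕ) : Set where
    constructor tribonacci
    field recursion : ∀ k → u (3 + k) ≡ u (2 + k) + u (1 + k) + u k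

  trib-shift : ∀ {u} → Tribonacci u → Tribonacci (λ k → u (suc k))
  trib-shift (tribonacci rec) = tribonacci (λ k → rec (suc k))

  trib-+ : ∀ {u v} → Tribonacci u → Tribonacci v → Tribonacci (λ k → u k + v k)
  trib-+ {u} {v} (tribonacci recu) (tribonacci recv) = tribonacci λ k →
    trans (cong₂ _+_ (recu k) (recv k)) (interleave (u (2 + k)) (u (1 + k)) (u k) (v (2 + k)) (v (1 + k)) (v k))
    where
    interleave : ∀ a b c a′ b′ c′ → (a + b + c) + (a′ + b′ + c′) ≡ (a + a′) + (b + b′) + (c + c′)
    interleave = solve-∀

  trib-* : ∀ c {u} → Tribonacci u → Tribonacci (λ k → c * u k)
  trib-* c {u} (tribonacci rec) = tribonacci λ k →
    trans (cong (c *_) (rec k)) (distrib c (u (2 + k)) (u (1 + k)) (u k))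
    where
    distrib : ∀ c a b e → c * (a + b + e) ≡ c * a + c * b + c * e
    distrib = solve-∀

  trib-unique : ∀ {u v} → Tribonacci u → Tribonacci v →
    u 0 ≡ v 0 → u 1 ≡ v 1 → u 2 ≡ v 2 → ∀ n → u n ≡ v n
  trib-unique {u} {v} (tribonacci recu) (tribonacci recv) e₀ e₁ e₂ = agree
    where
    agree : ∀ n → u n ≡ v n
    agree 0 = e₀
    agree 1 = e₁
    agree 2 = e₂
    agree (suc (suc (suc n))) =
      trans (recu n) (trans (cong₂ _+_ (cong₂ _+_ (agree (suc (suc n))) (agree (suc n))) (agree n)) (sym (recv n)))

  K-tribonacci : Tribonacci K
  K-tribonacci = tribonacci (λ k → refl)

  -- Summing Pascal's rule for D over the triangle.
  Tr-recursion : ∀ k → Tr (3 + k) ≡ Tr (2 + k) + Tr (1 + k) + Tr k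
  Tr-recursion k = begin
    Tr (3 + k)                                              ≡⟨ tri-cong r (D-pascal k) ⟩
    tri r (λ i j → D (2 + k) i j + shifted k 1 i j)         ≡⟨ tri-+ r (D (2 + k)) (shifted k 1) ⟩
    tri r (D (2 + k)) + tri r (shifted k 1)                 ≡⟨ cong₂ _+_ (Tr-widen (2 + k) (s≤s (⌊n/2⌋-mono (n≤1+n (2 + k)))))
                                                                         (tri-shifted k 1) ⟩
    Tr (2 + k) + (Tr (1 + k) + 1 * Tr k)                    ≡⟨ cong (λ v → Tr (2 + k) + (Tr (1 + k) + v)) (*-identityˡ (Tr k)) ⟩
    Tr (2 + k) + (Tr (1 + k) + Tr k)                        ≡⟨ sym (+-assoc (Tr (2 + k)) _ _) ⟩
    Tr (2 + k) + Tr (1 + k) + Tr k                          ∎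
    where
    r : ℕ
    r = suc ⌊ 3 + k /2⌋

  -- K(k+3) = Tr(k+3) + Tr(k+1) + 2 Tr k, both sides being Tribonacci sequences.
  K≡Tr : ∀ k → K (3 + k) ≡ Tr (3 + k) + (Tr (1 + k) + 2 * Tr k)
  K≡Tr = trib-unique
    (trib-shift (trib-shift (trib-shift K-tribonacci)))
    (trib-+ (trib-shift (trib-shift (trib-shift Tr-tribonacci)))
            (trib-+ (trib-shift Tr-tribonacci) (trib-* 2 Tr-tribonacci)))
    refl refl refl
    where
    Tr-tribonacci : Tribonacci Tr
    Tr-tribonacci = tribonacci Tr-recursion

  tri-summand : ∀ k → tri (suc ⌊ 3 + k /2⌋) (summand k) ≡ K (3 + k)
  tri-summand k = begin
    tri (suc ⌊ 3 + k /2⌋) (summand k)                               ≡⟨ tri-+ (suc ⌊ 3 + k /2⌋) (D (3 + k)) (shifted k 2) ⟩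
    Tr (3 + k) + tri (suc ⌊ 3 + k /2⌋) (shifted k 2)                 ≡⟨ cong (Tr (3 + k) +_) (tri-shifted k 2) ⟩
    Tr (3 + k) + (Tr (1 + k) + 2 * Tr k)                             ≡⟨ sym (K≡Tr k) ⟩
    K (3 + k)                                                        ∎

open import Defs
open import Data.Nat as ℕ using (ℕ; zero; suc; ⌊_/2⌋; _≤_)
open import Data.Nat.Combinatorics using (_C_)
open import Data.Integer as ℤ using (+_)
import Data.Integer.Properties as ℤ
open import Data.Nat.Properties using (m∸n≡0⇒m≤n; *-comm)
open import Data.Rational using (ℚ; 0ℚ; 1ℚ; _+_; _*_; _-_; _/_; fromℚᵘ)
open import Data.Rational.Properties using (toℚᵘ-injective; toℚᵘ-fromℚᵘ; fromℚᵘ-cong; toℚᵘ-homo-+; *-distribˡ-+)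
open import Data.Rational.Unnormalised as ℚᵘ using (mkℚᵘ; *≡*)
import Data.Rational.Unnormalised.Properties as ℚᵘ
open import Data.Rational.Solver using (module +-*-Solver)
open import Relation.Binary.PropositionalEquality
open ≡-Reasoning
open TribonacciCounting using (Σ<; tri; summand; summand-overflow; summand-slack; tri-summand; C≡binom)

fromℚᵘ-+ : ∀ p q → fromℚᵘ (p ℚᵘ.+ q) ≡ fromℚᵘ p + fromℚᵘ q
fromℚᵘ-+ p q = toℚᵘ-injective (ℚᵘ.≃-trans (toℚᵘ-fromℚᵘ _)
  (ℚᵘ.≃-trans (ℚᵘ.+-cong (ℚᵘ.≃-sym (toℚᵘ-fromℚᵘ p)) (ℚᵘ.≃-sym (toℚᵘ-fromℚᵘ q)))
    (ℚᵘ.≃-sym (toℚᵘ-homo-+ (fromℚᵘ p) (fromℚᵘ q)))))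

ι-+ : ∀ a b → ι (a ℕ.+ b) ≡ ι a + ι b
ι-+ a b = trans (fromℚᵘ-cong {mkℚᵘ (+ (a ℕ.+ b)) 0} {mkℚᵘ (+ a) 0 ℚᵘ.+ mkℚᵘ (+ b) 0} (*≡* numerators))
                (fromℚᵘ-+ (mkℚᵘ (+ a) 0) (mkℚᵘ (+ b) 0))
  where
  numerators : + (a ℕ.+ b) ℤ.* + 1 ≡ (+ a ℤ.* + 1 ℤ.+ + b ℤ.* + 1) ℤ.* + 1
  numerators = cong (ℤ._* + 1) (trans (ℤ.pos-+ a b)
    (sym (cong₂ ℤ._+_ (ℤ.*-identityʳ (+ a)) (ℤ.*-identityʳ (+ b)))))

ι-/ : ∀ d x → (+ (suc d ℕ.* x)) / suc d ≡ ι x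
ι-/ d x = fromℚᵘ-cong {mkℚᵘ (+ (suc d ℕ.* x)) d} {mkℚᵘ (+ x) 0} (*≡* numerators)
  where
  numerators : + (suc d ℕ.* x) ℤ.* + 1 ≡ + x ℤ.* + suc d
  numerators = trans (ℤ.*-identityʳ _) (trans (cong +_ (*-comm (suc d) x)) (ℤ.pos-* x (suc d)))

term-overflow : ∀ n i j → n ℕ.∸ (i ℕ.+ j) ≡ 0 → term n i j ≡ 0ℚ
term-overflow n i j slack rewrite slack = refl

term-slack : ∀ n i j d → n ℕ.∸ (i ℕ.+ j) ≡ suc d →
  term n i j ≡ (+ (n ℕ.* (i C j) ℕ.* (suc d C i))) / suc d
term-slack n i j d slack rewrite slack = refl

term≡summand : ∀ k i j → term (3 ℕ.+ k) i j ≡ ι (summand k i j)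
term≡summand k i j = by-slack _ refl
  where
  by-slack : ∀ s → (3 ℕ.+ k) ℕ.∸ (i ℕ.+ j) ≡ s → term (3 ℕ.+ k) i j ≡ ι (summand k i j)
  by-slack zero slack = trans (term-overflow (3 ℕ.+ k) i j slack)
    (cong ι (sym (summand-overflow k i j (m∸n≡0⇒m≤n slack))))
  by-slack (suc d) slack = begin
    term (3 ℕ.+ k) i j                                   ≡⟨ term-slack (3 ℕ.+ k) i j d slack ⟩
    (+ ((3 ℕ.+ k) ℕ.* (i C j) ℕ.* (suc d C i))) / suc d  ≡⟨ cong (λ x → (+ x) / suc d) numerator ⟩
    (+ (suc d ℕ.* summand k i j)) / suc d                ≡⟨ ι-/ d (summand k i j) ⟩
    ι (summand k i j)                                    ∎
    where
    numerator : (3 ℕ.+ k) ℕ.* (i C j) ℕ.* (suc d C i) ≡ suc d ℕ.* summand k i j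
    numerator = trans (cong₂ (λ u v → (3 ℕ.+ k) ℕ.* u ℕ.* v) (C≡binom i j) (C≡binom (suc d) i))
                      (summand-slack k i j d slack)

Σ≤-cong : ∀ m {f g : ℕ → ℚ} → (∀ i → f i ≡ g i) → Σ≤ m f ≡ Σ≤ m g
Σ≤-cong zero eq = eq 0
Σ≤-cong (suc m) eq = cong₂ _+_ (Σ≤-cong m eq) (eq (suc m))

Σ≤-ι : ∀ m f → Σ≤ m (λ i → ι (f i)) ≡ ι (Σ< (suc m) f)
Σ≤-ι zero f = refl
Σ≤-ι (suc m) f = trans (cong (_+ ι (f (suc m))) (Σ≤-ι m f)) (sym (ι-+ (Σ< (suc m) f) (f (suc m))))

Σ≤-distrib : ∀ m c f → Σ≤ m (λ j → c * f j) ≡ c * Σ≤ m f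
Σ≤-distrib zero c f = refl
Σ≤-distrib (suc m) c f =
  trans (cong (_+ c * f (suc m)) (Σ≤-distrib m c f)) (sym (*-distribˡ-+ c (Σ≤ m f) (f (suc m))))

abel : ∀ (g : ℕ → ℚ) l → Σ≤ l (λ s → Σ≤ s g) ≡ ι (suc l) * Σ≤ l g - Σ≤ l (λ i → ι i * g i)
abel g zero = solve 1 (λ x → x := con 1ℚ :* x :- con 0ℚ :* x) refl (g 0)
  where open +-*-Solver
abel g (suc l) = begin
  Σ≤ l (λ s → Σ≤ s g) + (G + g′)                       ≡⟨ cong (_+ (G + g′)) (abel g l) ⟩
  (x * G - H) + (G + g′)                               ≡⟨ step x G g′ H ⟩
  (1ℚ + x) * (G + g′) - (H + x * g′)                   ≡⟨ cong (λ y → y * (G + g′) - (H + x * g′)) (sym (ι-+ 1 (suc l))) ⟩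
  ι (suc (suc l)) * (G + g′) - (H + x * g′)            ∎
  where
  open +-*-Solver
  x G g′ H : ℚ
  x = ι (suc l)
  G = Σ≤ l g
  g′ = g (suc l)
  H = Σ≤ l (λ i → ι i * g i)
  step : ∀ x G g′ H → (x * G - H) + (G + g′) ≡ (1ℚ + x) * (G + g′) - (H + x * g′)
  step = solve 4 (λ x G g′ H → (x :* G :- H) :+ (G :+ g′) := (con 1ℚ :+ x) :* (G :+ g′) :- (H :+ x :* g′)) refl

complete-sum : ∀ n → 1 ≤ n → Σ≤ ⌊ n /2⌋ (λ i → Σ≤ i (term n i)) ≡ ι (K n)
complete-sum 1 _ = refl
complete-sum 2 _ = refl
complete-sum (suc (suc (suc k))) _ = begin
  Σ≤ l (λ i → Σ≤ i (term (3 ℕ.+ k) i))                 ≡⟨ Σ≤-cong l (λ i → Σ≤-cong i (term≡summand k i)) ⟩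
  Σ≤ l (λ i → Σ≤ i (λ j → ι (summand k i j)))          ≡⟨ Σ≤-cong l (λ i → Σ≤-ι i (summand k i)) ⟩
  Σ≤ l (λ i → ι (Σ< (suc i) (summand k i)))            ≡⟨ Σ≤-ι l _ ⟩
  ι (tri (suc l) (summand k))                          ≡⟨ cong ι (tri-summand k) ⟩
  ι (K (3 ℕ.+ k))                                      ∎
  where
  l : ℕ
  l = ⌊ 3 ℕ.+ k /2⌋

corollary8 : (n : ℕ) → 1 ≤ n →
    Σ≤ ⌊ n /2⌋ (λ s → Kinc n s)
    ≡ ι (suc ⌊ n /2⌋) * ι (K n)
    - Σ≤ ⌊ n /2⌋ (λ i → Σ≤ i (λ j → ι i * term n i j))
corollary8 n 1≤n = begin
  Σ≤ l (λ s → Σ≤ s g)                                   ≡⟨ abel g l ⟩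
  ι (suc l) * Σ≤ l g - Σ≤ l (λ i → ι i * g i)           ≡⟨ cong₂ (λ u v → ι (suc l) * u - v)
                                                            (complete-sum n 1≤n)
                                                            (Σ≤-cong l (λ i → sym (Σ≤-distrib i (ι i) (term n i)))) ⟩
  ι (suc l) * ι (K n) - Σ≤ l (λ i → Σ≤ i (λ j → ι i * term n i j)) ∎
  where
  l : ℕ
  l = ⌊ n /2⌋
  g : ℕ → ℚ
  g i = Σ≤ i (term n i)
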